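{- Let $G$ be a finite simple graph and $a$ a vertex of $G$. Then \[ J(G\mid a\in W)=x\,y^{|N_G(a)|}J(G-N_G[a])+x\bigl(J(G\backslash a)-J(G\mid N_G[a]\cap W=\emptyset)\bigr). \]
   Context: For a finite simple graph $G$ and $W\subseteq V(G)$, $N_G[W]$ is the set of vertices that are in $W$ or adjacent to a vertex of $W$, and $N_G(W):=N_G[W]\setminus W$; for a vertex $a$, $N_G(a)$ is the set of neighbours of $a$ and $N_G[a]=N_G(a)\cup\{a\}$. The bivariate domination polynomial is $J(G;x,y)=J(G):=\sum_{W\subseteq V(G)} x^{|W|}y^{|N_G(W)|}$ (the graph with no vertices has $J=1$). For a condition $c(W)$ on subsets $W\subseteq V(G)$, $J(G\mid c(W))$ is the same sum taken only over those $W$ satisfying $c(W)$. For $X\subseteq V(G)$, $G-X$ is obtained by deleting the vertices of $X$. The vertex contraction $G\backslash a$ is the graph obtained from $G$ by adding edges between all pairs of vertices of $N_G(a)$ and then deleting $a$. -}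

module Defs where

open import Level using (Level)
open import Data.Nat using (ℕ; zero; suc)
open import Data.Bool using (Bool; true; false; _∧_; _∨_; not; if_then_else_)
open import Data.Fin using (Fin; _≟_)
open import Data.List using (List; []; _∷_; map; _++_; foldr; filter; length; allFin)
open import Data.Bool.ListAction using (any; all)
open import Relation.Nullary.Decidable using (⌊_⌋)
open import Relation.Binary.PropositionalEquality using (_≡_)
open import Algebra.Bundles using (CommutativeRing)

-- A (finite) graph whose vertex set is a subset V of the ambient set Fin n,
-- with (Boolean) adjacency E.  Only edges between vertices of V matter.
record Graph (n : ℕ) : Set where
  field
    V : Fin n → Bool
    E : Fin n → Fin n → Bool
open Graph public

record IsSimple {n : ℕ} (G : Graph n) : Set where
  field
    sym   : ∀ u v → E G u v ≡ E G v u
    irref : ∀ u → E G u u ≡ false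

VSet : ℕ → Set
VSet n = Fin n → Bool

_==_ : ∀ {n} → Fin n → Fin n → Bool
u == v = ⌊ u ≟ v ⌋

subsets : (n : ℕ) → List (VSet n)
subsets zero = (λ ()) ∷ []
subsets (suc n) = map (λ W → ext false W) (subsets n) ++ map (λ W → ext true W) (subsets n)
  where
  ext : Bool → VSet n → VSet (suc n)
  ext b W Fin.zero = b
  ext b W (Fin.suc i) = W i

card : ∀ {n} → VSet n → ℕ
card {n} W = length (filter (λ i → W i ≡? true) (allFin n))
  where
  open import Data.Bool.Properties using () renaming (_≟_ to _≡?_)

_⊆V_ : ∀ {n} → VSet n → Graph n → Bool
_⊆V_ {n} W G = all (λ v → not (W v) ∨ V G v) (allFin n)

NW : ∀ {n} → Graph n → VSet n → VSet n
NW {n} G W v = V G v ∧ not (W v) ∧ any (λ w → W w ∧ V G w ∧ E G w v) (allFin n)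

Nv : ∀ {n} → Graph n → Fin n → VSet n
Nv G a u = V G u ∧ E G a u ∧ not (u == a)

Nc : ∀ {n} → Graph n → Fin n → VSet n
Nc G a u = V G u ∧ (u == a ∨ E G a u)

_─_ : ∀ {n} → Graph n → VSet n → Graph n
G ─ X = record { V = λ u → V G u ∧ not (X u) ; E = E G }

-- vertex contraction G \ a : join all pairs of N_G(a), then delete a
contract : ∀ {n} → Graph n → Fin n → Graph n
contract G a = record
  { V = λ u → V G u ∧ not (u == a)
  ; E = λ u v → E G u v ∨ (Nv G a u ∧ Nv G a v ∧ not (u == v)) }

module Poly {c ℓ : Level} (R : CommutativeRing c ℓ) where
  open CommutativeRing R

  pow : Carrier → ℕ → Carrier
  pow z zero = 1#
  pow z (suc k) = z * pow z k

  Jc : ∀ {n} → Carrier → Carrier → Graph n → (VSet n → Bool) → Carrier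
  Jc {n} x y G cond =
    foldr (λ W acc → (if (W ⊆V G) ∧ cond W
                        then pow x (card W) * pow y (card (NW G W))
                        else 0#) + acc)
          0# (subsets n)

  J : ∀ {n} → Carrier → Carrier → Graph n → Carrier
  J x y G = Jc x y G (λ _ → true)

disjNc : ∀ {n} → Graph n → Fin n → VSet n → Bool
disjNc {n} G a W = all (λ u → not (Nc G a u ∧ W u)) (allFin n)

module Submission where

-- The map U ↦ U △ {a} permutes the subsets, so the left side is
-- the sum over all U of the term of U △ {a} (sum-toggle).  For a ∉ U, U ⊆ V(G):
--  * if U ∩ N[a] = ∅, then N_G(U ∪ {a}) = N_G(a) ⊎ N_{G-N[a]}(U) and N_{G\a}(U) = N_G(U),
--    so the term of U ∪ {a} is x y^|N(a)| times the term of U in J(G - N[a]), while the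
--    two terms of U in the bracket cancel;
--  * otherwise some u ∈ U lies in N[a]; then N_G(U ∪ {a}) = N_{G\a}(U), and U contributes
--    to neither J(G - N[a]) nor J(G | N[a] ∩ W = ∅);
-- and if a ∈ U or U ⊄ V(G) every term vanishes.

open import Defs
open import Level using (Level)
open import Data.Nat using (ℕ)
open import Data.Fin using (Fin)
open import Data.Bool using (true)
open import Relation.Binary.PropositionalEquality using (_≡_)
open import Algebra.Bundles using (CommutativeRing)

open import Data.Nat using (zero; suc) renaming (_+_ to _+ℕ_)
open import Data.Nat.Properties using (+-suc)
open import Data.Fin using (zero; suc; _≟_)
open import Data.Fin.Properties using (¬∀⟶∃¬)
open import Data.Bool using (Bool; false; _∧_; _∨_; not; if_then_else_)
open import Data.Bool.Properties using (⇔→≡; not-¬; ¬-not; not-involutive; ∧-zeroʳ; ∧-identityʳ; T-≡)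
  renaming (_≟_ to _≟ᵇ_)
open import Data.Bool.ListAction using (all; any)
open import Data.List using (List; []; _∷_; map; _++_; foldr; filter; length; allFin; tabulate)
open import Data.List.Properties using (map-cong)
open import Data.List.Relation.Unary.All as All using ()
open import Data.List.Relation.Unary.All.Properties using (all⁺; all⁻)
open import Data.List.Relation.Unary.Any using (satisfied)
open import Data.List.Relation.Unary.Any.Properties using (any⁺; any⁻)
open import Data.List.Membership.Propositional using (lose)
open import Data.List.Membership.Propositional.Properties using (∈-allFin)
open import Data.Product using (∃; _×_; _,_; proj₁; proj₂)
open import Data.Sum using (_⊎_; inj₁; inj₂)
open import Data.Empty using (⊥; ⊥-elim)
open import Data.Maybe using (nothing)
open import Function.Bundles using (mk⇔; Equivalence)
open import Relation.Nullary using (yes; no)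
open import Relation.Nullary.Decidable using (dec-true; dec-false; isYes≗does)
open import Relation.Binary.PropositionalEquality using (refl; sym; trans; cong; cong₂; _≢_)
import Relation.Binary.PropositionalEquality as ≡
open import Algebra.Solver.Ring.AlmostCommutativeRing using (fromCommutativeRing; -raw-almostCommutative⟶)
import Relation.Binary.Reasoning.Setoid as SetoidReasoning

-- normalisation of commutative-ring expressions (no decidable equality is needed)
module RingSolver {c ℓ : Level} (R : CommutativeRing c ℓ) where
  open CommutativeRing R using (rawRing)
  open import Algebra.Solver.Ring rawRing (fromCommutativeRing R) (-raw-almostCommutative⟶ _) (λ _ _ → nothing) public

private
  variable
    n : ℕ

∧-true⁻ : ∀ {a b} → a ∧ b ≡ true → a ≡ true × b ≡ true
∧-true⁻ {true} p = refl , p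

∧-true⁺ : ∀ {a b} → a ≡ true → b ≡ true → a ∧ b ≡ true
∧-true⁺ refl q = q

∨-true⁻ : ∀ {a b} → a ∨ b ≡ true → a ≡ true ⊎ b ≡ true
∨-true⁻ {true}  _ = inj₁ refl
∨-true⁻ {false} q = inj₂ q

∨-trueˡ : ∀ {a b} → a ≡ true → a ∨ b ≡ true
∨-trueˡ refl = refl

∨-trueʳ : ∀ {a b} → b ≡ true → a ∨ b ≡ true
∨-trueʳ {true}  _ = refl
∨-trueʳ {false} q = q

bool-ext : ∀ {a b} → (a ≡ true → b ≡ true) → (b ≡ true → a ≡ true) → a ≡ b
bool-ext f g = ⇔→≡ (mk⇔ f g)

not-true⁻ : ∀ {a} → not a ≡ true → a ≡ false
not-true⁻ {false} _ = refl

not-false⁻ : ∀ {a} → a ≡ false → not a ≡ true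
not-false⁻ refl = refl

true≠false : ∀ {a} → a ≡ true → a ≡ false → ⊥
true≠false = not-¬

==-refl : (a : Fin n) → (a == a) ≡ true
==-refl a = trans (isYes≗does (a ≟ a)) (dec-true (a ≟ a) refl)

==-false : {u a : Fin n} → u ≢ a → (u == a) ≡ false
==-false {u = u} {a} u≢a = trans (isYes≗does (u ≟ a)) (dec-false (u ≟ a) u≢a)

==-false⁻ : {u a : Fin n} → not (u == a) ≡ true → u ≢ a
==-false⁻ {a = a} u≠a refl = true≠false (==-refl a) (not-true⁻ u≠a)

module _ (p : Fin n → Bool) where

  all-true⁻ : all p (allFin n) ≡ true → ∀ i → p i ≡ true
  all-true⁻ h i = Equivalence.to T-≡ (All.lookup (all⁺ p (allFin n) (Equivalence.from T-≡ h)) (∈-allFin i))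

  all-true⁺ : (∀ i → p i ≡ true) → all p (allFin n) ≡ true
  all-true⁺ h = Equivalence.to T-≡ (all⁻ p {allFin n} (All.tabulate (λ {i} _ → Equivalence.from T-≡ (h i))))

  all-false⁻ : all p (allFin n) ≡ false → ∃ λ i → p i ≡ false
  all-false⁻ h
    with ¬∀⟶∃¬ n (λ i → p i ≡ true) (λ i → p i ≟ᵇ true) (λ all-p → true≠false (all-true⁺ all-p) h)
  ... | i , ¬pi = i , ¬-not ¬pi

  any-true⁻ : any p (allFin n) ≡ true → ∃ λ i → p i ≡ true
  any-true⁻ h with satisfied (any⁻ p (allFin n) (Equivalence.from T-≡ h))
  ... | i , pi = i , Equivalence.to T-≡ pi

  any-true⁺ : ∀ i → p i ≡ true → any p (allFin n) ≡ true
  any-true⁺ i pi = Equivalence.to T-≡ (any⁺ p (lose (∈-allFin i) (Equivalence.from T-≡ pi)))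

infix 4 _∈_ _∉_ _≐_ _⊆_
infixr 6 _∪_

_∈_ : Fin n → VSet n → Set
v ∈ A = A v ≡ true

_∉_ : Fin n → VSet n → Set
v ∉ A = A v ≡ false

_⊆_ : VSet n → VSet n → Set
A ⊆ B = ∀ v → v ∈ A → v ∈ B

-- extensional equality of vertex sets (there is no function extensionality)
_≐_ : VSet n → VSet n → Set
A ≐ B = ∀ v → A v ≡ B v

_∪_ : VSet n → VSet n → VSet n
(A ∪ B) v = A v ∨ B v

Disjoint : VSet n → VSet n → Set
Disjoint A B = ∀ v → v ∈ A → v ∉ B

≐-intro : {A B : VSet n} → A ⊆ B → B ⊆ A → A ≐ B
≐-intro A⊆B B⊆A v = bool-ext (A⊆B v) (B⊆A v)

cons : Bool → VSet n → VSet (suc n)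
cons b W zero    = b
cons b W (suc i) = W i

cons-cong : ∀ b {W W' : VSet n} → W ≐ W' → cons b W ≐ cons b W'
cons-cong b W≐W' zero    = refl
cons-cong b W≐W' (suc i) = W≐W' i

-- toggle a U = U △ {a}.  It is defined along the cons-decomposition so that
-- toggle a (cons b W) computes; this makes its effect on subset sums easy to track.
toggle : Fin n → VSet n → VSet n
toggle zero    U = cons (not (U zero)) (λ i → U (suc i))
toggle (suc a) U = cons (U zero) (toggle a (λ i → U (suc i)))

toggle-here : (a : Fin n) (U : VSet n) → toggle a U a ≡ not (U a)
toggle-here zero    U = refl
toggle-here (suc a) U = toggle-here a (λ i → U (suc i))

toggle-there : (a : Fin n) (U : VSet n) {v : Fin n} → v ≢ a → toggle a U v ≡ U v
toggle-there zero    U {zero}  v≢a = ⊥-elim (v≢a refl)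
toggle-there zero    U {suc v} v≢a = refl
toggle-there (suc a) U {zero}  v≢a = refl
toggle-there (suc a) U {suc v} v≢a = toggle-there a (λ i → U (suc i)) (λ v≡a → v≢a (cong suc v≡a))

toggle-cong : (a : Fin n) {U U' : VSet n} → U ≐ U' → toggle a U ≐ toggle a U'
toggle-cong zero    U≐U' zero    = cong not (U≐U' zero)
toggle-cong zero    U≐U' (suc i) = U≐U' (suc i)
toggle-cong (suc a) U≐U' zero    = U≐U' zero
toggle-cong (suc a) U≐U' (suc i) = toggle-cong a (λ j → U≐U' (suc j)) i

module Insertion (a : Fin n) (U : VSet n) (a∉U : a ∉ U) where

  a∈toggle : a ∈ toggle a U
  a∈toggle = trans (toggle-here a U) (cong not a∉U)

  ∈U⇒≢a : ∀ {v} → v ∈ U → v ≢ a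
  ∈U⇒≢a v∈U refl = true≠false v∈U a∉U

  U⊆toggle : U ⊆ toggle a U
  U⊆toggle v v∈U = trans (toggle-there a U (∈U⇒≢a v∈U)) v∈U

  ∈toggle⁻ : ∀ v → v ∈ toggle a U → v ≡ a ⊎ v ∈ U
  ∈toggle⁻ v v∈ with v ≟ a
  ... | yes v≡a = inj₁ v≡a
  ... | no  v≢a = inj₂ (trans (sym (toggle-there a U v≢a)) v∈)

  ∉toggle⁻ : ∀ v → v ∉ toggle a U → v ≢ a × v ∉ U
  ∉toggle⁻ v v∉ with v ≟ a
  ... | yes refl = ⊥-elim (true≠false a∈toggle v∉)
  ... | no  v≢a  = v≢a , trans (sym (toggle-there a U v≢a)) v∉

  ∉toggle⁺ : ∀ {v} → v ≢ a → v ∉ U → v ∉ toggle a U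
  ∉toggle⁺ v≢a v∉U = trans (toggle-there a U v≢a) v∉U

-- Cardinality.  card counts by filtering allFin; count is the same number
-- computed by recursion on n, which makes the counting lemmas inductions.
count : VSet n → ℕ
count {zero}  W = 0
count {suc n} W = (if W zero then 1 else 0) +ℕ count (λ i → W (suc i))

card≡count : (W : VSet n) → card W ≡ count W
card≡count {n} W = count-tabulate n (λ i → i)
  where
  count-tabulate : ∀ m (g : Fin m → Fin n) →
    length (filter (λ i → W i ≟ᵇ true) (tabulate g)) ≡ count (λ i → W (g i))
  count-tabulate zero    g = refl
  count-tabulate (suc m) g with W (g zero)
  ... | true  = cong suc (count-tabulate m (λ i → g (suc i)))
  ... | false = count-tabulate m (λ i → g (suc i))

count-cong : {A B : VSet n} → A ≐ B → count A ≡ count B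
count-cong {zero}  A≐B = refl
count-cong {suc n} A≐B =
  cong₂ (λ b k → (if b then 1 else 0) +ℕ k) (A≐B zero) (count-cong (λ i → A≐B (suc i)))

count-∪ : (A B : VSet n) → Disjoint A B → count (A ∪ B) ≡ count A +ℕ count B
count-∪ {zero}  A B disj = refl
count-∪ {suc n} A B disj
  with A zero in A0 | B zero in B0 | count-∪ (λ i → A (suc i)) (λ i → B (suc i)) (λ i → disj (suc i))
... | true  | true  | _    = ⊥-elim (true≠false B0 (disj zero A0))
... | true  | false | rest = cong suc rest
... | false | true  | rest = trans (cong suc rest) (sym (+-suc _ _))
... | false | false | rest = rest

count-toggle : (a : Fin n) (U : VSet n) → a ∉ U → count (toggle a U) ≡ suc (count U)
count-toggle zero    U a∉U rewrite a∉U = refl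
count-toggle (suc a) U a∉U =
  trans (cong ((if U zero then 1 else 0) +ℕ_) (count-toggle a (λ i → U (suc i)) a∉U)) (+-suc _ _)

card-cong : {A B : VSet n} → A ≐ B → card A ≡ card B
card-cong {A = A} {B} A≐B = trans (card≡count A) (trans (count-cong A≐B) (sym (card≡count B)))

card-∪ : (A B : VSet n) → Disjoint A B → card (A ∪ B) ≡ card A +ℕ card B
card-∪ A B disj = trans (card≡count (A ∪ B))
  (trans (count-∪ A B disj) (sym (cong₂ _+ℕ_ (card≡count A) (card≡count B))))

card-toggle : (a : Fin n) (U : VSet n) → a ∉ U → card (toggle a U) ≡ suc (card U)
card-toggle a U a∉U = trans (card≡count (toggle a U))
  (trans (count-toggle a U a∉U) (sym (cong suc (card≡count U))))

⊆V-elim : {G : Graph n} {W : VSet n} → W ⊆V G ≡ true → W ⊆ V G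
⊆V-elim {G = G} {W} W⊆G v v∈W with ∨-true⁻ (all-true⁻ (λ u → not (W u) ∨ V G u) W⊆G v)
... | inj₁ v∉W = ⊥-elim (true≠false v∈W (not-true⁻ v∉W))
... | inj₂ v∈G = v∈G

⊆V-intro : {G : Graph n} {W : VSet n} → W ⊆ V G → W ⊆V G ≡ true
⊆V-intro {G = G} {W} W⊆G = all-true⁺ (λ u → not (W u) ∨ V G u) member
  where
  member : ∀ u → not (W u) ∨ V G u ≡ true
  member u with W u in u∈?
  ... | true  = W⊆G u u∈?
  ... | false = refl

⊆V-cong : (G : Graph n) {W W' : VSet n} → W ≐ W' → W ⊆V G ≡ W' ⊆V G
⊆V-cong {n} G W≐W' =
  cong (foldr _∧_ true) (map-cong (λ u → cong (λ b → not b ∨ V G u) (W≐W' u)) (allFin n))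

⊆V-toggle : {G : Graph n} {a : Fin n} → a ∈ V G → (U : VSet n) → a ∉ U → toggle a U ⊆V G ≡ U ⊆V G
⊆V-toggle {G = G} {a} a∈G U a∉U = bool-ext
  (λ T⊆G → ⊆V-intro {G = G} (λ v v∈U → ⊆V-elim {G = G} T⊆G v (U⊆toggle v v∈U)))
  (λ U⊆G → ⊆V-intro {G = G} (λ v v∈T → in-G U⊆G v (∈toggle⁻ v v∈T)))
  where
  open Insertion a U a∉U
  in-G : U ⊆V G ≡ true → ∀ v → v ≡ a ⊎ v ∈ U → v ∈ V G
  in-G U⊆G v (inj₁ refl) = a∈G
  in-G U⊆G v (inj₂ v∈U)  = ⊆V-elim {G = G} U⊆G v v∈U

record InBoundary (G : Graph n) (W : VSet n) (v : Fin n) : Set where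
  constructor boundary
  field
    v∈G       : v ∈ V G
    v∉W       : v ∉ W
    witness   : Fin n
    witness∈W : witness ∈ W
    witness∈G : witness ∈ V G
    edge      : E G witness v ≡ true

NW-elim : (G : Graph n) (W : VSet n) {v : Fin n} → v ∈ NW G W → InBoundary G W v
NW-elim G W {v} v∈N with ∧-true⁻ v∈N
... | v∈G , rest with ∧-true⁻ rest
... | v∉W , adjacent with any-true⁻ (λ w → W w ∧ V G w ∧ E G w v) adjacent
... | w , w∈W∧ with ∧-true⁻ w∈W∧
... | w∈W , w∈G∧ with ∧-true⁻ w∈G∧
... | w∈G , wv = boundary v∈G (not-true⁻ v∉W) w w∈W w∈G wv

NW-intro : (G : Graph n) (W : VSet n) {v : Fin n} → InBoundary G W v → v ∈ NW G W
NW-intro G W {v} (boundary v∈G v∉W w w∈W w∈G edge) =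
  ∧-true⁺ v∈G (∧-true⁺ (not-false⁻ v∉W)
    (any-true⁺ (λ u → W u ∧ V G u ∧ E G u v) w (∧-true⁺ w∈W (∧-true⁺ w∈G edge))))

NW-cong : (G : Graph n) {W W' : VSet n} → W ≐ W' → NW G W ≐ NW G W'
NW-cong {n} G W≐W' v = cong₂ (λ b c → V G v ∧ not b ∧ c) (W≐W' v)
  (cong (foldr _∨_ false) (map-cong (λ w → cong (λ b → b ∧ V G w ∧ E G w v) (W≐W' w)) (allFin n)))

disjointᵇ : VSet n → VSet n → Bool
disjointᵇ {n} X W = all (λ u → not (X u ∧ W u)) (allFin n)

disjointᵇ-elim : {X W : VSet n} → disjointᵇ X W ≡ true → Disjoint W X
disjointᵇ-elim {X = X} {W} disj v v∈W with X v in v∈X? | all-true⁻ (λ u → not (X u ∧ W u)) disj v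
... | false | _ = refl
... | true  | v∉X∩W = ⊥-elim (true≠false v∈W (not-true⁻ v∉X∩W))

disjointᵇ-intro : {X W : VSet n} → Disjoint W X → disjointᵇ X W ≡ true
disjointᵇ-intro {X = X} {W} disj = all-true⁺ (λ u → not (X u ∧ W u)) outside
  where
  outside : ∀ u → not (X u ∧ W u) ≡ true
  outside u with W u in u∈W?
  ... | false = not-false⁻ (∧-zeroʳ (X u))
  ... | true  = cong (λ b → not (b ∧ true)) (disj u u∈W?)

disjointᵇ-false : {X W : VSet n} → disjointᵇ X W ≡ false → ∃ λ v → v ∈ X × v ∈ W
disjointᵇ-false {X = X} {W} meet with all-false⁻ (λ u → not (X u ∧ W u)) meet
... | v , v∈X∩W = v , ∧-true⁻ (trans (sym (not-involutive (X v ∧ W v))) (cong not v∈X∩W))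

⊆V-delete : (G : Graph n) (X W : VSet n) → W ⊆V (G ─ X) ≡ (W ⊆V G) ∧ disjointᵇ X W
⊆V-delete G X W = bool-ext to from
  where
  to : W ⊆V (G ─ X) ≡ true → (W ⊆V G) ∧ disjointᵇ X W ≡ true
  to W⊆G─X = ∧-true⁺ (⊆V-intro {G = G} (λ v v∈W → proj₁ (∧-true⁻ (inG─X v v∈W))))
    (disjointᵇ-intro {X = X} (λ v v∈W → not-true⁻ (proj₂ (∧-true⁻ (inG─X v v∈W)))))
    where
    inG─X : W ⊆ V (G ─ X)
    inG─X = ⊆V-elim {G = G ─ X} W⊆G─X
  from : (W ⊆V G) ∧ disjointᵇ X W ≡ true → W ⊆V (G ─ X) ≡ true
  from both with ∧-true⁻ both
  ... | W⊆G , disj = ⊆V-intro {G = G ─ X} (λ v v∈W →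
    ∧-true⁺ (⊆V-elim {G = G} W⊆G v v∈W) (not-false⁻ (disjointᵇ-elim {X = X} disj v v∈W)))

disjointᵇ-singleton : (a : Fin n) (W : VSet n) → disjointᵇ (λ u → u == a) W ≡ not (W a)
disjointᵇ-singleton a W = bool-ext to from
  where
  to : disjointᵇ (λ u → u == a) W ≡ true → not (W a) ≡ true
  to disj with W a in a∈W?
  ... | false = refl
  ... | true  = ⊥-elim (true≠false (==-refl a) (disjointᵇ-elim {X = λ u → u == a} disj a a∈W?))
  from : not (W a) ≡ true → disjointᵇ (λ u → u == a) W ≡ true
  from a∉W = disjointᵇ-intro {X = λ u → u == a} (λ v v∈W → ==-false (v≢a v∈W))
    where
    v≢a : ∀ {v} → v ∈ W → v ≢ a
    v≢a v∈W refl = true≠false v∈W (not-true⁻ a∉W)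

module Neighbourhood (G : Graph n) (a : Fin n) where

  Nv-intro : ∀ {v} → v ∈ V G → E G a v ≡ true → v ≢ a → v ∈ Nv G a
  Nv-intro v∈G av v≢a = ∧-true⁺ v∈G (∧-true⁺ av (not-false⁻ (==-false v≢a)))

  Nv-elim : ∀ {v} → v ∈ Nv G a → v ∈ V G × E G a v ≡ true × v ≢ a
  Nv-elim v∈N with ∧-true⁻ v∈N
  ... | v∈G , rest with ∧-true⁻ rest
  ... | av , v≠a = v∈G , av , ==-false⁻ v≠a

  a∈Nc : a ∈ V G → a ∈ Nc G a
  a∈Nc a∈G = ∧-true⁺ a∈G (∨-trueˡ (==-refl a))

  Nv⊆Nc : Nv G a ⊆ Nc G a
  Nv⊆Nc v v∈N = ∧-true⁺ (proj₁ (Nv-elim v∈N)) (∨-trueʳ (proj₁ (proj₂ (Nv-elim v∈N))))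

  Nc⇒Nv : ∀ {v} → v ∈ Nc G a → v ≢ a → v ∈ Nv G a
  Nc⇒Nv v∈N v≢a with ∧-true⁻ v∈N
  ... | v∈G , v=a∨av with ∨-true⁻ v=a∨av
  ... | inj₁ v=a = ⊥-elim (true≠false v=a (==-false v≢a))
  ... | inj₂ av  = Nv-intro v∈G av v≢a

  ∉Nc⇒≢a : ∀ {v} → v ∈ V G → v ∉ Nc G a → v ≢ a
  ∉Nc⇒≢a v∈G v∉N refl = true≠false (a∈Nc v∈G) v∉N

  ∈contract⁺ : ∀ {v} → v ∈ V G → v ≢ a → v ∈ V (contract G a)
  ∈contract⁺ v∈G v≢a = ∧-true⁺ v∈G (not-false⁻ (==-false v≢a))

  ∈contract⁻ : ∀ {v} → v ∈ V (contract G a) → v ∈ V G × v ≢ a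
  ∈contract⁻ v∈C with ∧-true⁻ v∈C
  ... | v∈G , v≠a = v∈G , ==-false⁻ v≠a

  boundary-insert-apart : a ∈ V G → (U : VSet n) → a ∉ U → Disjoint U (Nc G a) →
    NW G (toggle a U) ≐ Nv G a ∪ NW (G ─ Nc G a) U
  boundary-insert-apart a∈G U a∉U apart = ≐-intro to from
    where
    open Insertion a U a∉U
    to : NW G (toggle a U) ⊆ Nv G a ∪ NW (G ─ Nc G a) U
    to v v∈N with NW-elim G (toggle a U) v∈N
    ... | boundary v∈G v∉W w w∈W w∈G wv with ∉toggle⁻ v v∉W | ∈toggle⁻ w w∈W
    ... | v≢a , v∉U | inj₁ refl = ∨-trueˡ (Nv-intro v∈G wv v≢a)
    ... | v≢a , v∉U | inj₂ w∈U with Nc G a v ≟ᵇ true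
    ...   | yes v∈Nc = ∨-trueˡ (Nc⇒Nv v∈Nc v≢a)
    ...   | no  v∉Nc = ∨-trueʳ (NW-intro (G ─ Nc G a) U
                (boundary (∧-true⁺ v∈G (not-false⁻ (¬-not v∉Nc))) v∉U
                          w w∈U (∧-true⁺ w∈G (not-false⁻ (apart w w∈U))) wv))
    from : Nv G a ∪ NW (G ─ Nc G a) U ⊆ NW G (toggle a U)
    from v v∈ with ∨-true⁻ v∈
    ... | inj₁ v∈Nv with Nv-elim v∈Nv
    ...   | v∈G , av , v≢a = NW-intro G (toggle a U) (boundary v∈G (∉toggle⁺ v≢a v∉U) a a∈toggle a∈G av)
      where
      v∉U : v ∉ U
      v∉U = ¬-not (λ v∈U → true≠false (Nv⊆Nc v v∈Nv) (apart v v∈U))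
    from v v∈ | inj₂ v∈N' with NW-elim (G ─ Nc G a) U v∈N'
    ... | boundary v∈G' v∉U w w∈U w∈G' wv with ∧-true⁻ v∈G'
    ...   | v∈G , v∉Nc = NW-intro G (toggle a U)
            (boundary v∈G (∉toggle⁺ (∉Nc⇒≢a v∈G (not-true⁻ v∉Nc)) v∉U)
                      w (U⊆toggle w w∈U) (proj₁ (∧-true⁻ w∈G')) wv)

  Nv-apart : (U : VSet n) → Disjoint (Nv G a) (NW (G ─ Nc G a) U)
  Nv-apart U v v∈Nv = ¬-not λ v∈N' →
    let v∈G─Nc = InBoundary.v∈G (NW-elim (G ─ Nc G a) U v∈N')
    in true≠false (Nv⊆Nc v v∈Nv) (not-true⁻ (proj₂ (∧-true⁻ v∈G─Nc)))

  -- If U misses N_G[a], contracting a does not change the boundary of U.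
  -- (Symmetry of G is needed to see that a itself is not adjacent to U.)
  boundary-contract-apart : IsSimple G → (U : VSet n) → Disjoint U (Nc G a) →
    NW (contract G a) U ≐ NW G U
  boundary-contract-apart simple U apart = ≐-intro to from
    where
    to : NW (contract G a) U ⊆ NW G U
    to v v∈N with NW-elim (contract G a) U v∈N
    ... | boundary v∈C v∉U w w∈U w∈C wv with ∨-true⁻ wv
    ... | inj₁ wv∈G  =
      NW-intro G U (boundary (proj₁ (∈contract⁻ v∈C)) v∉U w w∈U (proj₁ (∈contract⁻ w∈C)) wv∈G)
    ... | inj₂ joined = ⊥-elim (true≠false (Nv⊆Nc w (proj₁ (∧-true⁻ joined))) (apart w w∈U))
    from : NW G U ⊆ NW (contract G a) U
    from v v∈N with NW-elim G U v∈N
    ... | boundary v∈G v∉U w w∈U w∈G wv =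
      NW-intro (contract G a) U (boundary (∈contract⁺ v∈G v≢a) v∉U
        w w∈U (∈contract⁺ w∈G (∉Nc⇒≢a w∈G (apart w w∈U))) (∨-trueˡ wv))
      where
      v≢a : v ≢ a
      v≢a refl = true≠false (∧-true⁺ w∈G (∨-trueʳ (trans (IsSimple.sym simple a w) wv))) (apart w w∈U)

  -- If some u ∈ U lies in N_G[a], then N_G(U ∪ {a}) = N_{G\a}(U): the neighbours of a
  -- are reached from u through the clique that the contraction adds on N_G(a).
  boundary-insert-meeting : a ∈ V G → (U : VSet n) → a ∉ U → ∀ {u} → u ∈ Nc G a → u ∈ U →
    NW G (toggle a U) ≐ NW (contract G a) U
  boundary-insert-meeting a∈G U a∉U {u} u∈Nc u∈U = ≐-intro to from
    where
    open Insertion a U a∉U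
    u∈Nv : u ∈ Nv G a
    u∈Nv = Nc⇒Nv u∈Nc (∈U⇒≢a u∈U)
    to : NW G (toggle a U) ⊆ NW (contract G a) U
    to v v∈N with NW-elim G (toggle a U) v∈N
    ... | boundary v∈G v∉W w w∈W w∈G wv with ∉toggle⁻ v v∉W | ∈toggle⁻ w w∈W
    ... | v≢a , v∉U | inj₁ refl =
      NW-intro (contract G a) U (boundary (∈contract⁺ v∈G v≢a) v∉U
        u u∈U (∈contract⁺ (proj₁ (Nv-elim u∈Nv)) (∈U⇒≢a u∈U))
        (∨-trueʳ (∧-true⁺ u∈Nv (∧-true⁺ (Nv-intro v∈G wv v≢a) (not-false⁻ (==-false u≢v))))))
      where
      u≢v : u ≢ v
      u≢v refl = true≠false u∈U v∉U
    ... | v≢a , v∉U | inj₂ w∈U =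
      NW-intro (contract G a) U (boundary (∈contract⁺ v∈G v≢a) v∉U
        w w∈U (∈contract⁺ w∈G (∈U⇒≢a w∈U)) (∨-trueˡ wv))
    from : NW (contract G a) U ⊆ NW G (toggle a U)
    from v v∈N with NW-elim (contract G a) U v∈N
    ... | boundary v∈C v∉U w w∈U w∈C wv with ∈contract⁻ v∈C | ∨-true⁻ wv
    ... | v∈G , v≢a | inj₁ wv∈G =
      NW-intro G (toggle a U) (boundary v∈G (∉toggle⁺ v≢a v∉U)
        w (U⊆toggle w w∈U) (proj₁ (∈contract⁻ w∈C)) wv∈G)
    ... | v∈G , v≢a | inj₂ joined =
      NW-intro G (toggle a U) (boundary v∈G (∉toggle⁺ v≢a v∉U) a a∈toggle a∈G av)
      where
      v∈Nv : v ∈ Nv G a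
      v∈Nv = proj₁ (∧-true⁻ (proj₂ (∧-true⁻ {Nv G a w} joined)))
      av : E G a v ≡ true
      av = proj₁ (proj₂ (Nv-elim v∈Nv))

module SubsetSums {c ℓ : Level} (R : CommutativeRing c ℓ) where
  open CommutativeRing R hiding (zero) renaming (refl to ≈-refl; sym to ≈-sym; trans to ≈-trans)
  open SetoidReasoning setoid
  open RingSolver R
  open import Algebra.Properties.Group +-group using () renaming (ε⁻¹≈ε to -0≈0)
  open import Algebra.Properties.AbelianGroup +-abelianGroup using (⁻¹-∙-comm)

  sumOver : (VSet n → Carrier) → List (VSet n) → Carrier
  sumOver f = foldr (λ W acc → f W + acc) 0#

  Σₛ : (VSet n → Carrier) → Carrier
  Σₛ {n} f = sumOver f (subsets n)

  module _ {f g : VSet n → Carrier} where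

    sum-cong : (∀ W → f W ≈ g W) → ∀ Ws → sumOver f Ws ≈ sumOver g Ws
    sum-cong f≈g []       = ≈-refl
    sum-cong f≈g (W ∷ Ws) = +-cong (f≈g W) (sum-cong f≈g Ws)

    sum-+ : ∀ Ws → sumOver (λ W → f W + g W) Ws ≈ sumOver f Ws + sumOver g Ws
    sum-+ []       = ≈-sym (+-identityˡ 0#)
    sum-+ (W ∷ Ws) = begin
      (f W + g W) + sumOver (λ W → f W + g W) Ws
        ≈⟨ +-cong ≈-refl (sum-+ Ws) ⟩
      (f W + g W) + (sumOver f Ws + sumOver g Ws)
        ≈⟨ solve 4 (λ p q P Q → (p :+ q) :+ (P :+ Q) := (p :+ P) :+ (q :+ Q)) ≈-refl _ _ _ _ ⟩
      (f W + sumOver f Ws) + (g W + sumOver g Ws)   ∎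

  module _ {f : VSet n → Carrier} where

    sum-scale : ∀ k Ws → sumOver (λ W → k * f W) Ws ≈ k * sumOver f Ws
    sum-scale k []       = ≈-sym (zeroʳ k)
    sum-scale k (W ∷ Ws) = ≈-trans (+-cong ≈-refl (sum-scale k Ws)) (≈-sym (distribˡ k (f W) (sumOver f Ws)))

    sum-neg : ∀ Ws → sumOver (λ W → - f W) Ws ≈ - sumOver f Ws
    sum-neg []       = ≈-sym -0≈0
    sum-neg (W ∷ Ws) = ≈-trans (+-cong ≈-refl (sum-neg Ws)) (⁻¹-∙-comm (f W) (sumOver f Ws))

    sum-++ : ∀ Ws Ws' → sumOver f (Ws ++ Ws') ≈ sumOver f Ws + sumOver f Ws'
    sum-++ []       Ws' = ≈-sym (+-identityˡ _)
    sum-++ (W ∷ Ws) Ws' = ≈-trans (+-cong ≈-refl (sum-++ Ws Ws')) (≈-sym (+-assoc _ _ _))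

  sum-map : ∀ {m} (f : VSet n → Carrier) (g : VSet m → VSet n) Ws →
    sumOver f (map g Ws) ≡ sumOver (λ W → f (g W)) Ws
  sum-map f g []       = ≡.refl
  sum-map f g (W ∷ Ws) = ≡.cong (f (g W) +_) (sum-map f g Ws)

  -- summands must respect extensional equality of subsets, as we cannot use funext
  Respects≐ : (VSet n → Carrier) → Set _
  Respects≐ f = ∀ {W W'} → W ≐ W' → f W ≈ f W'

  sum-split : {f : VSet (suc n) → Carrier} → Respects≐ f →
    Σₛ f ≈ Σₛ (λ W → f (cons false W)) + Σₛ (λ W → f (cons true W))
  sum-split {n} {f} f-resp =
    by-halves _ _ (λ W → λ { zero → ≡.refl ; (suc i) → ≡.refl })
                  (λ W → λ { zero → ≡.refl ; (suc i) → ≡.refl })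
    where
    by-halves : (g₀ g₁ : VSet n → VSet (suc n)) →
      (∀ W → g₀ W ≐ cons false W) → (∀ W → g₁ W ≐ cons true W) →
      sumOver f (map g₀ (subsets n) ++ map g₁ (subsets n))
        ≈ Σₛ (λ W → f (cons false W)) + Σₛ (λ W → f (cons true W))
    by-halves g₀ g₁ g₀≐ g₁≐ = begin
      sumOver f (map g₀ (subsets n) ++ map g₁ (subsets n))
        ≈⟨ sum-++ (map g₀ (subsets n)) (map g₁ (subsets n)) ⟩
      sumOver f (map g₀ (subsets n)) + sumOver f (map g₁ (subsets n))
        ≡⟨ ≡.cong₂ _+_ (sum-map f g₀ (subsets n)) (sum-map f g₁ (subsets n)) ⟩
      sumOver (λ W → f (g₀ W)) (subsets n) + sumOver (λ W → f (g₁ W)) (subsets n)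
        ≈⟨ +-cong (sum-cong (λ W → f-resp (g₀≐ W)) (subsets n))
                  (sum-cong (λ W → f-resp (g₁≐ W)) (subsets n)) ⟩
      Σₛ (λ W → f (cons false W)) + Σₛ (λ W → f (cons true W)) ∎

  -- U ↦ U △ {a} is a bijection of the subsets, so it does not change a subset sum
  sum-toggle : (a : Fin n) {f : VSet n → Carrier} → Respects≐ f → Σₛ f ≈ Σₛ (λ U → f (toggle a U))
  sum-toggle zero {f} f-resp = begin
    Σₛ f
      ≈⟨ sum-split f-resp ⟩
    Σₛ (λ W → f (cons false W)) + Σₛ (λ W → f (cons true W))
      ≈⟨ +-comm _ _ ⟩
    Σₛ (λ W → f (cons true W)) + Σₛ (λ W → f (cons false W))
      ≈⟨ sum-split (λ U≐U' → f-resp (toggle-cong zero U≐U')) ⟨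
    Σₛ (λ U → f (toggle zero U)) ∎
  sum-toggle (suc a) {f} f-resp = begin
    Σₛ f
      ≈⟨ sum-split f-resp ⟩
    Σₛ (λ W → f (cons false W)) + Σₛ (λ W → f (cons true W))
      ≈⟨ +-cong (sum-toggle a (λ W≐W' → f-resp (cons-cong false W≐W')))
                (sum-toggle a (λ W≐W' → f-resp (cons-cong true W≐W'))) ⟩
    Σₛ (λ W → f (cons false (toggle a W))) + Σₛ (λ W → f (cons true (toggle a W)))
      ≈⟨ sum-split (λ U≐U' → f-resp (toggle-cong (suc a) U≐U')) ⟨
    Σₛ (λ U → f (toggle (suc a) U)) ∎

module Expansion {c ℓ : Level} (R : CommutativeRing c ℓ) (x y : CommutativeRing.Carrier R) where
  open CommutativeRing R hiding (zero) renaming (refl to ≈-refl; sym to ≈-sym; trans to ≈-trans)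
  open Poly R
  open SubsetSums R
  open RingSolver R
  open SetoidReasoning setoid
  open import Algebra.Properties.Group +-group using () renaming (ε⁻¹≈ε to -0≈0)

  pow-+ : ∀ z i j → pow z (i +ℕ j) ≈ pow z i * pow z j
  pow-+ z zero    j = ≈-sym (*-identityˡ (pow z j))
  pow-+ z (suc i) j = ≈-trans (*-cong ≈-refl (pow-+ z i j)) (≈-sym (*-assoc z (pow z i) (pow z j)))

  weight : Graph n → VSet n → Carrier
  weight H W = pow x (card W) * pow y (card (NW H W))

  guarded : Bool → Carrier → Carrier
  guarded b w = if b then w else 0#

  -- the summand of J(H | cond); by definition  Jc x y H cond = Σₛ (summand H cond)
  summand : Graph n → (VSet n → Bool) → VSet n → Carrier
  summand H cond W = guarded ((W ⊆V H) ∧ cond W) (weight H W)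

  summand-resp : (H : Graph n) (cond : VSet n → Bool) → (∀ {W W'} → W ≐ W' → cond W ≡ cond W') →
    Respects≐ (summand H cond)
  summand-resp H cond cond-resp W≐W' = reflexive (cong₂ guarded
    (cong₂ _∧_ (⊆V-cong H W≐W') (cond-resp W≐W'))
    (cong₂ (λ i j → pow x i * pow y j) (card-cong W≐W') (card-cong (NW-cong H W≐W'))))

  vanishing : (k : Carrier) → 0# ≈ k * 0# + x * (0# + - 0#)
  vanishing k = ≈-sym (begin
    k * 0# + x * (0# + - 0#)          ≈⟨ +-cong (zeroʳ k) (*-cong ≈-refl (-‿inverseʳ 0#)) ⟩
    0# + x * 0#                       ≈⟨ +-identityˡ (x * 0#) ⟩
    x * 0#                            ≈⟨ zeroʳ x ⟩
    0#                                ∎)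

  -- The Boolean case analysis behind the recurrence, for the guards
  -- s = [U ⊆ V(G)], a∉ = [a ∉ U], d = [U ∩ N[a] = ∅]  (d implies a∉).
  case-split : (k : Carrier) (s a∉ d : Bool) {w₀ w₁ w₂ w₃ : Carrier} →
    (d ≡ true → a∉ ≡ true) →
    (a∉ ≡ true → d ≡ true → w₀ ≈ k * w₁ × w₂ ≈ w₃) →
    (a∉ ≡ true → d ≡ false → w₀ ≈ x * w₂) →
    guarded (s ∧ a∉) w₀ ≈ k * guarded (s ∧ d) w₁ + x * (guarded (s ∧ a∉) w₂ + - guarded (s ∧ d) w₃)
  case-split k false _     _     _    _     _        = vanishing k
  case-split k true  false true  d⇒a∉ _    _        = ⊥-elim (true≠false (d⇒a∉ refl) refl)
  case-split k true  false false _    _     _        = vanishing k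
  case-split k true  true  true  {w₀} {w₁} {w₂} {w₃} _ apart _ with apart refl refl
  ... | w₀≈kw₁ , w₂≈w₃ = begin
    w₀                                ≈⟨ w₀≈kw₁ ⟩
    k * w₁                            ≈⟨ +-identityʳ (k * w₁) ⟨
    k * w₁ + 0#                       ≈⟨ +-cong ≈-refl (zeroʳ x) ⟨
    k * w₁ + x * 0#                   ≈⟨ +-cong ≈-refl (*-cong ≈-refl (-‿inverseʳ w₂)) ⟨
    k * w₁ + x * (w₂ + - w₂)          ≈⟨ +-cong ≈-refl (*-cong ≈-refl (+-cong ≈-refl (-‿cong w₂≈w₃))) ⟩
    k * w₁ + x * (w₂ + - w₃)          ∎
  case-split k true  true  false {w₀} {w₁} {w₂} _ _ meet = begin
    w₀                                ≈⟨ meet refl refl ⟩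
    x * w₂                            ≈⟨ +-identityˡ (x * w₂) ⟨
    0# + x * w₂                       ≈⟨ +-cong (zeroʳ k) (*-cong ≈-refl w₂-0≈w₂) ⟨
    k * 0# + x * (w₂ + - 0#)          ∎
    where
    w₂-0≈w₂ : w₂ + - 0# ≈ w₂
    w₂-0≈w₂ = ≈-trans (+-cong ≈-refl -0≈0) (+-identityʳ w₂)

  module AtVertex (G : Graph n) (simple : IsSimple G) (a : Fin n) (a∈G : a ∈ V G) where
    open Neighbourhood G a

    k : Carrier
    k = x * pow y (card (Nv G a))

    guard-toggle : (U : VSet n) → (toggle a U ⊆V G) ∧ toggle a U a ≡ (U ⊆V G) ∧ not (U a)
    guard-toggle U with U a in a∈U?
    ... | true  = trans (cong ((toggle a U ⊆V G) ∧_) (trans (toggle-here a U) (cong not a∈U?)))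
                        (trans (∧-zeroʳ _) (sym (∧-zeroʳ _)))
    ... | false = cong₂ _∧_ (⊆V-toggle {G = G} a∈G U a∈U?) (Insertion.a∈toggle a U a∈U?)

    guard-delete : (U : VSet n) → (U ⊆V (G ─ Nc G a)) ∧ true ≡ (U ⊆V G) ∧ disjNc G a U
    guard-delete U = trans (∧-identityʳ _) (⊆V-delete G (Nc G a) U)

    guard-contract : (U : VSet n) → (U ⊆V contract G a) ∧ true ≡ (U ⊆V G) ∧ not (U a)
    guard-contract U = trans (∧-identityʳ _)
      (trans (⊆V-delete G (λ u → u == a) U) (cong ((U ⊆V G) ∧_) (disjointᵇ-singleton a U)))

    apart⇒a∉U : (U : VSet n) → disjNc G a U ≡ true → not (U a) ≡ true
    apart⇒a∉U U apart =
      not-false⁻ (¬-not (λ a∈U → true≠false (a∈Nc a∈G) (disjointᵇ-elim {X = Nc G a} apart a a∈U)))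

    weight-apart : (U : VSet n) → a ∉ U → Disjoint U (Nc G a) →
      weight G (toggle a U) ≈ k * weight (G ─ Nc G a) U
    weight-apart U a∉U apart = begin
      pow x (card (toggle a U)) * pow y (card (NW G (toggle a U)))
        ≡⟨ cong₂ (λ i j → pow x i * pow y j) (card-toggle a U a∉U)
             (trans (card-cong (boundary-insert-apart a∈G U a∉U apart)) (card-∪ (Nv G a) _ (Nv-apart U))) ⟩
      (x * X) * pow y (card (Nv G a) +ℕ card (NW (G ─ Nc G a) U))
        ≈⟨ *-cong ≈-refl (pow-+ y (card (Nv G a)) (card (NW (G ─ Nc G a) U))) ⟩
      (x * X) * (pow y (card (Nv G a)) * Y)
        ≈⟨ solve 4 (λ x X d Y → (x :* X) :* (d :* Y) := (x :* d) :* (X :* Y)) ≈-refl x X _ Y ⟩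
      k * (X * Y) ∎
      where
      X Y : Carrier
      X = pow x (card U)
      Y = pow y (card (NW (G ─ Nc G a) U))

    weight-contract-apart : (U : VSet n) → Disjoint U (Nc G a) → weight (contract G a) U ≡ weight G U
    weight-contract-apart U apart =
      cong (λ j → pow x (card U) * pow y j) (card-cong (boundary-contract-apart simple U apart))

    weight-meeting : (U : VSet n) → a ∉ U → ∀ {u} → u ∈ Nc G a → u ∈ U →
      weight G (toggle a U) ≈ x * weight (contract G a) U
    weight-meeting U a∉U u∈Nc u∈U = begin
      pow x (card (toggle a U)) * pow y (card (NW G (toggle a U)))
        ≡⟨ cong₂ (λ i j → pow x i * pow y j) (card-toggle a U a∉U)
             (card-cong (boundary-insert-meeting a∈G U a∉U u∈Nc u∈U)) ⟩
      (x * pow x (card U)) * pow y (card (NW (contract G a) U))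
        ≈⟨ *-assoc x _ _ ⟩
      x * weight (contract G a) U ∎

    pointwise : (U : VSet n) →
      summand G (λ W → W a) (toggle a U)
        ≈ k * summand (G ─ Nc G a) (λ _ → true) U
          + x * (summand (contract G a) (λ _ → true) U + - summand G (disjNc G a) U)
    pointwise U = begin
      guarded ((toggle a U ⊆V G) ∧ toggle a U a) w₀
        ≡⟨ cong (λ b → guarded b w₀) (guard-toggle U) ⟩
      guarded (s ∧ not (U a)) w₀
        ≈⟨ case-split k s (not (U a)) d (apart⇒a∉U U) apart-case meeting-case ⟩
      k * guarded (s ∧ d) w₁ + x * (guarded (s ∧ not (U a)) w₂ + - guarded (s ∧ d) w₃)
        ≡⟨ sym (cong₂ (λ p q → k * guarded p w₁ + x * (guarded q w₂ + - guarded (s ∧ d) w₃))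
                      (guard-delete U) (guard-contract U)) ⟩
      k * guarded ((U ⊆V (G ─ Nc G a)) ∧ true) w₁
        + x * (guarded ((U ⊆V contract G a) ∧ true) w₂ + - guarded (s ∧ d) w₃) ∎
      where
      s d : Bool
      s  = U ⊆V G
      d  = disjNc G a U
      w₀ w₁ w₂ w₃ : Carrier
      w₀ = weight G (toggle a U)
      w₁ = weight (G ─ Nc G a) U
      w₂ = weight (contract G a) U
      w₃ = weight G U
      apart-case : not (U a) ≡ true → d ≡ true → w₀ ≈ k * w₁ × w₂ ≈ w₃
      apart-case a∉U apart = weight-apart U (not-true⁻ a∉U) apart′ , reflexive (weight-contract-apart U apart′)
        where
        apart′ : Disjoint U (Nc G a)
        apart′ = disjointᵇ-elim {X = Nc G a} apart
      meeting-case : not (U a) ≡ true → d ≡ false → w₀ ≈ x * w₂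
      meeting-case a∉U meet with disjointᵇ-false {X = Nc G a} meet
      ... | u , u∈Nc , u∈U = weight-meeting U (not-true⁻ a∉U) u∈Nc u∈U

corollary1 : {c ℓ : Level} (R : CommutativeRing c ℓ) {n : ℕ} (G : Graph n) → IsSimple G →
    (a : Fin n) → V G a ≡ true →
    let open CommutativeRing R
        open Poly R
    in (x y : Carrier) →
      Jc x y G (λ W → W a)
        ≈ (x * pow y (card (Nv G a))) * J x y (G ─ Nc G a)
          + x * (J x y (contract G a)
                 + - Jc x y G (disjNc G a))
corollary1 R {n} G simple a a∈G x y = begin
  Σₛ (summand G (λ W → W a))
    ≈⟨ sum-toggle a (summand-resp G (λ W → W a) (λ W≐W' → W≐W' a)) ⟩
  Σₛ (λ U → summand G (λ W → W a) (toggle a U))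
    ≈⟨ sum-cong pointwise (subsets n) ⟩
  Σₛ (λ U → k * T₁ U + x * (T₂ U + - T₃ U))
    ≈⟨ sum-+ (subsets n) ⟩
  Σₛ (λ U → k * T₁ U) + Σₛ (λ U → x * (T₂ U + - T₃ U))
    ≈⟨ +-cong (sum-scale k (subsets n)) (sum-scale x (subsets n)) ⟩
  k * Σₛ T₁ + x * Σₛ (λ U → T₂ U + - T₃ U)
    ≈⟨ +-cong ≈-refl (*-cong ≈-refl (≈-trans (sum-+ (subsets n)) (+-cong ≈-refl (sum-neg (subsets n))))) ⟩
  k * Σₛ T₁ + x * (Σₛ T₂ + - Σₛ T₃) ∎
  where
  open CommutativeRing R hiding (zero) renaming (refl to ≈-refl; trans to ≈-trans)
  open SetoidReasoning setoid
  open SubsetSums R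
  open Expansion R x y
  open AtVertex G simple a a∈G
  T₁ T₂ T₃ : VSet n → Carrier
  T₁ = summand (G ─ Nc G a) (λ _ → true)
  T₂ = summand (contract G a) (λ _ → true)
  T₃ = summand G (disjNc G a)
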